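{- Let $n\ge 2$ and $m$ be integers with $0<m<n$. Then \[ \sum_{\substack{\frac{h}{k}\in\mathcal{F}(\mathbb{B}(n),m):\\ \frac{0}{1}<\frac{h}{k}<\frac{1}{1}}}\ \sum_{1\leq s\leq \left\lfloor\min\left\{\frac{m}{h},\ \frac{n-m}{k-h}\right\}\right\rfloor}\binom{m}{s h}\binom{n-m}{s(k-h)} =\sum_{\substack{\frac{h}{k}\in\mathcal{F}(\mathbb{B}(n),n-m):\\ \frac{0}{1}<\frac{h}{k}<\frac{1}{1}}}\ \sum_{1\leq s\leq \left\lfloor\min\left\{\frac{n-m}{h},\ \frac{m}{k-h}\right\}\right\rfloor}\binom{n-m}{s h}\binom{m}{s(k-h)} =2^n-2^m-2^{n-m}+1 . \]
   Context: For a positive integer $n$, the Farey sequence $\mathcal{F}_n$ is the ascending sequence of irreducible fractions $\frac{h}{k}$ (with integers $0\le h\le k\le n$, $k\ge1$, $\gcd(h,k)=1$; in particular it contains $\frac01$ and $\frac11$). For integers $0<m<n$, $\mathcal{F}(\mathbb{B}(n),m)$ denotes the ascending subsequence $\left(\frac{h}{k}\in\mathcal{F}_n:\ h\le m,\ k-h\le n-m\right)$; equivalently it is the set of reduced forms of the fractions $|B\cap A|/|B|$ over nonempty subsets $B$ of an $n$-set $C$, where $A\subset C$ is a fixed subset with $|A|=m$. In the sums, each fraction $\frac hk$ is written in lowest terms. -}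

module Defs where

open import Data.Nat using (ℕ; zero; suc; _+_; _*_; _∸_; _≤?_; _<?_; _⊓_)
open import Data.Nat.DivMod using (_/_)
open import Data.Nat.GCD using (gcd)
open import Data.Nat.Combinatorics using (_C_)
open import Data.Nat.Properties using (_≟_)
open import Data.Bool using (Bool; true; false; if_then_else_; _∧_)
open import Relation.Nullary.Decidable using (⌊_⌋)

sumFromTo : ℕ → ℕ → (ℕ → ℕ) → ℕ
sumFromTo lo hi f = go (suc hi ∸ lo)
  where
  go : ℕ → ℕ
  go zero = 0
  go (suc r) = f (lo + r) + go r

-- Membership test: h/k (with 0 < h/k < 1, i.e. 1 ≤ h < k) is a reduced fraction
-- of F(B(n),m), i.e. k ≤ n, gcd h k = 1, h ≤ m and k - h ≤ n - m.
-- (h ≥ 1 and h < k are guaranteed by the summation ranges below.)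
inFBinner : ℕ → ℕ → ℕ → ℕ → Bool
inFBinner n m h k =
  ⌊ k Data.Nat.≤? n ⌋ ∧ ⌊ gcd h k ≟ 1 ⌋ ∧ ⌊ h ≤? m ⌋ ∧ ⌊ (k ∸ h) ≤? (n ∸ m) ⌋

-- Sum over the fractions h/k ∈ F(B(n),m) with 0/1 < h/k < 1/1 (each in lowest
-- terms, enumerated once as the pair (h,k) with 1 ≤ h < k ≤ n) of g h k.
sumFB : ℕ → ℕ → (ℕ → ℕ → ℕ) → ℕ
sumFB n m g =
  sumFromTo 1 n λ k → sumFromTo 1 (k ∸ 1) λ h →
    if inFBinner n m h k then g h k else 0

-- Within the sum h ≥ 1 and k - h ≥ 1; the divisions below use suc-predecessor
-- to avoid the NonZero requirement, which agrees on those values.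
innerSum : ℕ → ℕ → ℕ → ℕ → ℕ
innerSum a b h k =
  sumFromTo 1 ((a / suc (h ∸ 1)) ⊓ (b / suc ((k ∸ h) ∸ 1))) λ s →
    (a C (s * h)) * (b C (s * (k ∸ h)))

module Submission where

open import Defs
open import Data.Bool using (Bool; true; false; if_then_else_)
open import Data.Empty using (⊥; ⊥-elim)
open import Data.Nat
open import Data.Nat.Combinatorics using (_C_; k>n⇒nCk≡0; nCk+nC[k+1]≡[n+1]C[k+1])
open import Data.Nat.Coprimality as Coprimality using (Coprime; coprime⇒gcd≡1; gcd≡1⇒coprime; coprime-+; coprime-/gcd)
open import Data.Nat.Divisibility using (_∣_; ∣m∣n⇒∣m+n)
open import Data.Nat.DivMod using (_/_; m*n/n≡m; m/n*n≡m; /-monoˡ-≤)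
open import Data.Nat.GCD
open import Data.Nat.Properties
open import Data.Nat.Tactic.RingSolver using (solve-∀)
open import Data.Product using (_×_; _,_; ∃-syntax)
open import Data.Sum using (inj₁)
open import Relation.Binary.PropositionalEquality
open import Relation.Nullary using (yes; no)
open import Relation.Nullary.Decidable using (⌊_⌋)

-- Both sums are (2^m − 1)(2^(n−m) − 1): every pair (i, j) with 1 ≤ i ≤ m and 1 ≤ j ≤ n − m
-- is (s h, s (k − h)) for exactly one fraction h/k of F(B(n),m) strictly between 0 and 1
-- and one admissible s, namely s = gcd i j, h = i / s, k − h = j / s. So the double sum
-- counts C(m,i) C(n−m,j) over all such pairs, which factors as
-- (Σ_{i ≥ 1} C(m,i)) (Σ_{j ≥ 1} C(n−m,j)). Exchanging m and n − m gives the same product.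

sumBelow : ℕ → (ℕ → ℕ) → ℕ
sumBelow zero    f = 0
sumBelow (suc N) f = f N + sumBelow N f

sumFromTo-1 : ∀ hi f → sumFromTo 1 hi f ≡ sumBelow hi (λ i → f (suc i))
sumFromTo-1 zero     f = refl
sumFromTo-1 (suc hi) f = cong (f (suc hi) +_) (sumFromTo-1 hi f)

sumBelow-cong : ∀ N {f g : ℕ → ℕ} → (∀ i → i < N → f i ≡ g i) → sumBelow N f ≡ sumBelow N g
sumBelow-cong zero    eq = refl
sumBelow-cong (suc N) eq = cong₂ _+_ (eq N ≤-refl) (sumBelow-cong N (λ i i<N → eq i (m<n⇒m<1+n i<N)))

sumBelow-zero : ∀ N {f} → (∀ i → i < N → f i ≡ 0) → sumBelow N f ≡ 0
sumBelow-zero zero    eq = refl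
sumBelow-zero (suc N) eq = cong₂ _+_ (eq N ≤-refl) (sumBelow-zero N (λ i i<N → eq i (m<n⇒m<1+n i<N)))

sumBelow-single : ∀ N {f} i₀ → i₀ < N → (∀ i → i < N → i ≢ i₀ → f i ≡ 0) → sumBelow N f ≡ f i₀
sumBelow-single (suc N) {f} i₀ i₀<1+N vanish with i₀ ≟ N
... | yes refl = begin
  f i₀ + sumBelow N f ≡⟨ cong (f i₀ +_) (sumBelow-zero N (λ i i<N → vanish i (m<n⇒m<1+n i<N) (<⇒≢ i<N))) ⟩
  f i₀ + 0            ≡⟨ +-identityʳ (f i₀) ⟩
  f i₀                ∎
  where open ≡-Reasoning
... | no i₀≢N = cong₂ _+_ (vanish N ≤-refl (≢-sym i₀≢N))
                          (sumBelow-single N i₀ (≤∧≢⇒< (≤-pred i₀<1+N) i₀≢N)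
                             (λ i i<N → vanish i (m<n⇒m<1+n i<N)))

sumBelow-suc : ∀ N f → sumBelow (suc N) f ≡ f 0 + sumBelow N (λ i → f (suc i))
sumBelow-suc zero    f = refl
sumBelow-suc (suc N) f = trans (cong (f (suc N) +_) (sumBelow-suc N f)) (x+[y+z]≡y+[x+z] (f (suc N)) (f 0) _)
  where
  x+[y+z]≡y+[x+z] : ∀ x y z → x + (y + z) ≡ y + (x + z)
  x+[y+z]≡y+[x+z] = solve-∀

sumBelow-+ : ∀ N (f g : ℕ → ℕ) → sumBelow N (λ i → f i + g i) ≡ sumBelow N f + sumBelow N g
sumBelow-+ zero    f g = refl
sumBelow-+ (suc N) f g = trans (cong (f N + g N +_) (sumBelow-+ N f g)) (+-interchange (f N) (g N) _ _)
  where
  +-interchange : ∀ a b c d → (a + b) + (c + d) ≡ (a + c) + (b + d)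
  +-interchange = solve-∀

sumBelow-comm : ∀ N M (f : ℕ → ℕ → ℕ) →
  sumBelow N (λ i → sumBelow M (f i)) ≡ sumBelow M (λ j → sumBelow N (λ i → f i j))
sumBelow-comm zero    M f = sym (sumBelow-zero M (λ _ _ → refl))
sumBelow-comm (suc N) M f = trans (cong (sumBelow M (f N) +_) (sumBelow-comm N M f))
                                  (sym (sumBelow-+ M (f N) (λ j → sumBelow N (λ i → f i j))))

sumBelow-*ˡ : ∀ N c (f : ℕ → ℕ) → c * sumBelow N f ≡ sumBelow N (λ i → c * f i)
sumBelow-*ˡ zero    c f = *-zeroʳ c
sumBelow-*ˡ (suc N) c f = trans (*-distribˡ-+ c (f N) _) (cong (c * f N +_) (sumBelow-*ˡ N c f))

sumBelow-*ʳ : ∀ N c (f : ℕ → ℕ) → sumBelow N f * c ≡ sumBelow N (λ i → f i * c)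
sumBelow-*ʳ N c f = trans (*-comm (sumBelow N f) c)
                          (trans (sumBelow-*ˡ N c f) (sumBelow-cong N (λ i _ → *-comm c (f i))))

sumBelow-*-sumBelow : ∀ N M (f g : ℕ → ℕ) →
  sumBelow N f * sumBelow M g ≡ sumBelow N (λ i → sumBelow M (λ j → f i * g j))
sumBelow-*-sumBelow N M f g =
  trans (sumBelow-*ʳ N (sumBelow M g) f) (sumBelow-cong N (λ i _ → sumBelow-*ˡ M (f i) g))

sumBelow-binomial : ∀ m N → m < N → sumBelow N (m C_) ≡ 2 ^ m
sumBelow-binomial zero    N       0<N = sumBelow-single N 0 0<N (λ i _ i≢0 → k>n⇒nCk≡0 (n≢0⇒n>0 i≢0))
sumBelow-binomial (suc m) (suc N) (s≤s m<N) = begin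
  sumBelow (suc N) (suc m C_)                               ≡⟨ sumBelow-suc N _ ⟩
  1 + sumBelow N (λ i → suc m C suc i)                      ≡⟨ cong (1 +_) (sumBelow-cong N (λ i _ → sym (nCk+nC[k+1]≡[n+1]C[k+1] m i))) ⟩
  1 + sumBelow N (λ i → m C i + m C suc i)                  ≡⟨ cong (1 +_) (sumBelow-+ N _ _) ⟩
  1 + (sumBelow N (m C_) + sumBelow N (λ i → m C suc i))    ≡⟨ x+[y+z]≡y+[x+z] 1 _ _ ⟩
  sumBelow N (m C_) + (1 + sumBelow N (λ i → m C suc i))    ≡⟨ cong (sumBelow N (m C_) +_) (sym (sumBelow-suc N _)) ⟩
  sumBelow N (m C_) + sumBelow (suc N) (m C_)                ≡⟨ cong₂ _+_ (sumBelow-binomial m N m<N)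
                                                                     (sumBelow-binomial m (suc N) (m<n⇒m<1+n m<N)) ⟩
  2 ^ m + 2 ^ m                                               ≡⟨ cong (2 ^ m +_) (sym (+-identityʳ (2 ^ m))) ⟩
  2 ^ suc m                                                   ∎
  where
  open ≡-Reasoning
  x+[y+z]≡y+[x+z] : ∀ x y z → x + (y + z) ≡ y + (x + z)
  x+[y+z]≡y+[x+z] = solve-∀

binomialSum⁺ : ℕ → ℕ
binomialSum⁺ m = sumBelow m (λ i → m C suc i)

2^m≡1+binomialSum⁺ : ∀ m → 2 ^ m ≡ 1 + binomialSum⁺ m
2^m≡1+binomialSum⁺ m = trans (sym (sumBelow-binomial m (suc m) ≤-refl)) (sumBelow-suc m _)

δ : ℕ → ℕ → ℕ
δ i p = if ⌊ i ≟ p ⌋ then 1 else 0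

δ-refl : ∀ i → δ i i ≡ 1
δ-refl i with i ≟ i
... | yes _   = refl
... | no i≢i = ⊥-elim (i≢i refl)

δ-≢ : ∀ {i p} → i ≢ p → δ i p ≡ 0
δ-≢ {i} {p} i≢p with i ≟ p
... | yes i≡p = ⊥-elim (i≢p i≡p)
... | no _    = refl

δ*δ-≢ : ∀ i p j q → (i ≡ p → j ≡ q → ⊥) → δ i p * δ j q ≡ 0
δ*δ-≢ i p j q ≢ with i ≟ p | j ≟ q
... | yes i≡p | yes j≡q = ⊥-elim (≢ i≡p j≡q)
... | yes _   | no _    = refl
... | no _    | _       = refl

sumBelow-δ : ∀ N (f : ℕ → ℕ) p → sumBelow N (λ i → f i * δ i p) ≡ (if ⌊ p <? N ⌋ then f p else 0)
sumBelow-δ N f p with p <? N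
... | yes p<N = trans (sumBelow-single N p p<N (λ i _ i≢p → trans (cong (f i *_) (δ-≢ i≢p)) (*-zeroʳ (f i))))
                      (trans (cong (f p *_) (δ-refl p)) (*-identityʳ (f p)))
... | no p≮N  = sumBelow-zero N (λ i i<N → trans (cong (f i *_) (δ-≢ (λ { refl → p≮N i<N }))) (*-zeroʳ (f i)))

binomial-as-δ-sum : ∀ a p → a C p ≡ sumBelow (suc a) (λ i → (a C i) * δ i p)
binomial-as-δ-sum a p with p <? suc a | sumBelow-δ (suc a) (a C_) p
... | yes _    | eq = sym eq
... | no p≮1+a | eq = trans (k>n⇒nCk≡0 (≰⇒> (λ p≤a → p≮1+a (s≤s p≤a)))) (sym eq)

sgn : ℕ → ℕ
sgn zero    = 0
sgn (suc _) = 1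

binomialSum⁺-as-sgn-sum : ∀ a → binomialSum⁺ a ≡ sumBelow (suc a) (λ i → (a C i) * sgn i)
binomialSum⁺-as-sgn-sum a = begin
  sumBelow a (λ i → a C suc i)
    ≡⟨ sumBelow-cong a (λ i _ → sym (*-identityʳ (a C suc i))) ⟩
  sumBelow a (λ i → (a C suc i) * sgn (suc i))
    ≡⟨ cong (_+ sumBelow a (λ i → (a C suc i) * sgn (suc i))) (sym (*-zeroʳ (a C 0))) ⟩
  (a C 0) * sgn 0 + sumBelow a (λ i → (a C suc i) * sgn (suc i))
    ≡⟨ sym (sumBelow-suc a (λ i → (a C i) * sgn i)) ⟩
  sumBelow (suc a) (λ i → (a C i) * sgn i) ∎
  where open ≡-Reasoning

-- The summation indices (x, y, z) stand for k = x + 1, h = y + 1, s = z + 1, and the pair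
-- is (i, j) = (s h, s (k − h)) with h/k reduced and 0 < h < k.
FareyDecomposition : ℕ → ℕ → ℕ → ℕ → ℕ → Set
FareyDecomposition i j x y z = y < x × gcd (suc y) (suc x) ≡ 1 × i ≡ suc z * suc y × j ≡ suc z * (x ∸ y)

coprime-∸ : ∀ {h k} → h ≤ k → Coprime h k → Coprime h (k ∸ h)
coprime-∸ {h} {k} h≤k coprime {d} (d∣h , d∣k∸h) =
  coprime (d∣h , subst (d ∣_) (m+[n∸m]≡n h≤k) (∣m∣n⇒∣m+n d∣h d∣k∸h))

decomposition-gcd : ∀ {i j x y z} → FareyDecomposition i j x y z → suc z ≡ gcd i j
decomposition-gcd {x = x} {y} {z} (y<x , gcd≡1 , refl , refl) = begin
  suc z                                 ≡⟨ sym (*-identityʳ (suc z)) ⟩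
  suc z * 1                             ≡⟨ cong (suc z *_) (sym (coprime⇒gcd≡1 (coprime-∸ (s≤s (<⇒≤ y<x)) (gcd≡1⇒coprime gcd≡1)))) ⟩
  suc z * gcd (suc y) (x ∸ y)           ≡⟨ c*gcd[m,n]≡gcd[cm,cn] (suc z) (suc y) (x ∸ y) ⟩
  gcd (suc z * suc y) (suc z * (x ∸ y)) ∎
  where open ≡-Reasoning

decomposition-unique : ∀ {i j x y z x′ y′ z′} →
  FareyDecomposition i j x y z → FareyDecomposition i j x′ y′ z′ → x ≡ x′ × y ≡ y′ × z ≡ z′
decomposition-unique {x = x} {y} {z} {x′} {y′} {z′} d@(y<x , _ , i≡ , j≡) d′@(y′<x′ , _ , i≡′ , j≡′)
  with suc-injective {z} {z′} (trans (decomposition-gcd d) (sym (decomposition-gcd d′)))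
... | refl = x≡x′ , y≡y′ , refl
  where
  y≡y′ : y ≡ y′
  y≡y′ = suc-injective (*-cancelˡ-≡ (suc y) (suc y′) (suc z) (trans (sym i≡) i≡′))
  x≡x′ : x ≡ x′
  x≡x′ = begin
    x                  ≡⟨ sym (m+[n∸m]≡n (<⇒≤ y<x)) ⟩
    y + (x ∸ y)        ≡⟨ cong₂ _+_ y≡y′ (*-cancelˡ-≡ (x ∸ y) (x′ ∸ y′) (suc z) (trans (sym j≡) j≡′)) ⟩
    y′ + (x′ ∸ y′)     ≡⟨ m+[n∸m]≡n (<⇒≤ y′<x′) ⟩
    x′                 ∎
    where open ≡-Reasoning

decomposition-exists : ∀ i j → ∃[ x ] ∃[ y ] ∃[ z ] FareyDecomposition (suc i) (suc j) x y z
decomposition-exists i j =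
  decompose g (suc i / g) (suc j / g)
            (sym (g*[m/g]≡m (gcd[m,n]∣m (suc i) (suc j)))) (sym (g*[m/g]≡m (gcd[m,n]∣n (suc i) (suc j))))
            (coprime-/gcd (suc i) (suc j)) g≢0 (m/gcd[m,n]≢0 (suc i) (suc j)) (n/gcd[m,n]≢0 (suc i) (suc j))
  where
  g = gcd (suc i) (suc j)
  g≢0 : g ≢ 0
  g≢0 = gcd[m,n]≢0 (suc i) (suc j) (inj₁ (λ ()))
  instance
    g-nonZero : NonZero g
    g-nonZero = ≢-nonZero g≢0
  g*[m/g]≡m : ∀ {m} → g ∣ m → g * (m / g) ≡ m
  g*[m/g]≡m g∣m = trans (*-comm g _) (m/n*n≡m g∣m)
  decompose : ∀ {i j} s h q → i ≡ s * h → j ≡ s * q → Coprime h q → s ≢ 0 → h ≢ 0 → q ≢ 0 →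
    ∃[ x ] ∃[ y ] ∃[ z ] FareyDecomposition i j x y z
  decompose zero    _       _       _   _   _      s≢0 _   _   = ⊥-elim (s≢0 refl)
  decompose (suc _) zero    _       _   _   _      _   h≢0 _   = ⊥-elim (h≢0 refl)
  decompose (suc _) (suc _) zero    _   _   _      _   _   q≢0 = ⊥-elim (q≢0 refl)
  decompose (suc z) (suc y) (suc w) i≡ j≡ coprime _ _ _ =
    y + suc w , y , z , m<m+n y (s≤s z≤n) ,
    coprime⇒gcd≡1 (Coprimality.sym (coprime-+ (Coprimality.sym coprime))) , i≡ ,
    trans j≡ (cong (suc z *_) (sym (m+n∸m≡n y (suc w))))

inFBinner-intro : ∀ n m h k → k ≤ n → gcd h k ≡ 1 → h ≤ m → k ∸ h ≤ n ∸ m → inFBinner n m h k ≡ true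
inFBinner-intro n m h k k≤n gcd≡1 h≤m k∸h≤n∸m with k ≤? n | gcd h k ≟ 1 | h ≤? m | (k ∸ h) ≤? (n ∸ m)
... | yes _ | yes _ | yes _ | yes _ = refl
... | no ¬p | _     | _     | _     = ⊥-elim (¬p k≤n)
... | yes _ | no ¬p | _     | _     = ⊥-elim (¬p gcd≡1)
... | yes _ | yes _ | no ¬p | _     = ⊥-elim (¬p h≤m)
... | yes _ | yes _ | yes _ | no ¬p = ⊥-elim (¬p k∸h≤n∸m)

inFBinner⇒gcd≡1 : ∀ n m h k → inFBinner n m h k ≡ true → gcd h k ≡ 1
inFBinner⇒gcd≡1 n m h k with k ≤? n
... | no _ = λ ()
... | yes _ with gcd h k ≟ 1
...   | yes gcd≡1 = λ _ → gcd≡1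
...   | no _      = λ ()

-- The divisor suc (q ∸ 1) is the one innerSum uses in place of q.
*≤⇒≤/ : ∀ p q c → 0 < q → p * q ≤ c → p ≤ c / suc (q ∸ 1)
*≤⇒≤/ p (suc q) c _ pq≤c = ≤-trans (≤-reflexive (sym (m*n/n≡m p (suc q)))) (/-monoˡ-≤ (suc q) pq≤c)

nestedSum : ℕ → (ℕ → ℕ → Bool) → (ℕ → ℕ → ℕ) → (ℕ → ℕ → ℕ → ℕ) → ℕ
nestedSum n G B φ = sumBelow n λ x → sumBelow x λ y → if G x y then sumBelow (B x y) (φ x y) else 0

module _ (n : ℕ) (G : ℕ → ℕ → Bool) (B : ℕ → ℕ → ℕ) where

  nestedSum-cong : ∀ {φ ψ} → (∀ x y z → φ x y z ≡ ψ x y z) → nestedSum n G B φ ≡ nestedSum n G B ψ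
  nestedSum-cong eq = sumBelow-cong n (λ x _ → sumBelow-cong x (λ y _ →
    cong (if G x y then_else 0) (sumBelow-cong (B x y) (λ z _ → eq x y z))))

  nestedSum-sumBelow : ∀ M (ψ : ℕ → ℕ → ℕ → ℕ → ℕ) →
    nestedSum n G B (λ x y z → sumBelow M (λ i → ψ i x y z)) ≡ sumBelow M (λ i → nestedSum n G B (ψ i))
  nestedSum-sumBelow M ψ =
    trans (sumBelow-cong n (λ x _ → trans (sumBelow-cong x (λ y _ →
                trans (cong (if G x y then_else 0) (sumBelow-comm (B x y) M (λ z i → ψ i x y z)))
                      (if-sumBelow (G x y))))
            (sumBelow-comm x M _)))
          (sumBelow-comm n M _)
    where
    if-sumBelow : ∀ b {f : ℕ → ℕ} → (if b then sumBelow M f else 0) ≡ sumBelow M (λ i → if b then f i else 0)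
    if-sumBelow true  = refl
    if-sumBelow false = sym (sumBelow-zero M (λ _ _ → refl))

  nestedSum-*ˡ : ∀ c (ψ : ℕ → ℕ → ℕ → ℕ) → nestedSum n G B (λ x y z → c * ψ x y z) ≡ c * nestedSum n G B ψ
  nestedSum-*ˡ c ψ =
    sym (trans (sumBelow-*ˡ n c _) (sumBelow-cong n (λ x _ → trans (sumBelow-*ˡ x c _) (sumBelow-cong x (λ y _ →
      trans (if-*ˡ (G x y)) (cong (if G x y then_else 0) (sumBelow-*ˡ (B x y) c (ψ x y))))))))
    where
    if-*ˡ : ∀ b {t} → c * (if b then t else 0) ≡ (if b then c * t else 0)
    if-*ˡ true  = refl
    if-*ˡ false = *-zeroʳ c

  nestedSum-zero : ∀ {φ} → (∀ x y z → y < x → φ x y z ≡ 0) → nestedSum n G B φ ≡ 0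
  nestedSum-zero vanish = sumBelow-zero n (λ x _ → sumBelow-zero x (λ y y<x → if-zero (G x y)
    (sumBelow-zero (B x y) (λ z _ → vanish x y z y<x))))
    where
    if-zero : ∀ b {t} → t ≡ 0 → (if b then t else 0) ≡ 0
    if-zero true  t≡0 = t≡0
    if-zero false _   = refl

  nestedSum-single : ∀ {φ x₀ y₀ z₀} → x₀ < n → y₀ < x₀ → G x₀ y₀ ≡ true → z₀ < B x₀ y₀ →
    (∀ x y z → y < x → G x y ≡ true → (x ≡ x₀ → y ≡ y₀ → z ≡ z₀ → ⊥) → φ x y z ≡ 0) →
    nestedSum n G B φ ≡ φ x₀ y₀ z₀
  nestedSum-single {φ} {x₀} {y₀} {z₀} x₀<n y₀<x₀ G₀ z₀<B vanish = begin
    nestedSum n G B φ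
      ≡⟨ sumBelow-single n x₀ x₀<n (λ x _ x≢x₀ → sumBelow-zero x (λ y y<x → off x y y<x (λ x≡x₀ _ → x≢x₀ x≡x₀))) ⟩
    sumBelow x₀ (λ y → if G x₀ y then sumBelow (B x₀ y) (φ x₀ y) else 0)
      ≡⟨ sumBelow-single x₀ y₀ y₀<x₀ (λ y y<x₀ y≢y₀ → off x₀ y y<x₀ (λ _ y≡y₀ → y≢y₀ y≡y₀)) ⟩
    (if G x₀ y₀ then sumBelow (B x₀ y₀) (φ x₀ y₀) else 0)
      ≡⟨ cong (if_then sumBelow (B x₀ y₀) (φ x₀ y₀) else 0) G₀ ⟩
    sumBelow (B x₀ y₀) (φ x₀ y₀)
      ≡⟨ sumBelow-single (B x₀ y₀) z₀ z₀<B (λ z _ z≢z₀ → vanish x₀ y₀ z y₀<x₀ G₀ (λ _ _ z≡z₀ → z≢z₀ z≡z₀)) ⟩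
    φ x₀ y₀ z₀ ∎
    where
    open ≡-Reasoning
    off : ∀ x y → y < x → (x ≡ x₀ → y ≡ y₀ → ⊥) → (if G x y then sumBelow (B x y) (φ x y) else 0) ≡ 0
    off x y y<x ≢ with G x y in eq
    ... | false = refl
    ... | true  = sumBelow-zero (B x y) (λ z _ → vanish x y z y<x eq (λ x≡ y≡ _ → ≢ x≡ y≡))

module FareySum (n a : ℕ) (a≤n : a ≤ n) where

  b : ℕ
  b = n ∸ a

  admissible : ℕ → ℕ → Bool
  admissible x y = inFBinner n a (suc y) (suc x)

  bound : ℕ → ℕ → ℕ
  bound x y = (a / suc y) ⊓ (b / suc ((x ∸ y) ∸ 1))

  fareySum : (ℕ → ℕ → ℕ → ℕ) → ℕ
  fareySum = nestedSum n admissible bound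

  sumFB≡fareySum : sumFB n a (innerSum a b) ≡ fareySum (λ x y z → (a C (suc z * suc y)) * (b C (suc z * (x ∸ y))))
  sumFB≡fareySum = trans (sumFromTo-1 n _) (sumBelow-cong n (λ x _ → trans (sumFromTo-1 x _) (sumBelow-cong x (λ y _ →
              cong (if admissible x y then_else 0) (sumFromTo-1 (bound x y) _)))))

  count : ∀ i j → i ≤ a → j ≤ b → fareySum (λ x y z → δ i (suc z * suc y) * δ j (suc z * (x ∸ y))) ≡ sgn i * sgn j
  count zero    j       _   _   = nestedSum-zero n admissible bound (λ _ _ _ _ → refl)
  count (suc i) zero    _   _   = nestedSum-zero n admissible bound (λ x y z y<x →
    trans (cong (δ (suc i) (suc z * suc y) *_) (δ-≢ (<⇒≢ (≤-trans (m<n⇒0<n∸m y<x) (m≤n*m (x ∸ y) (suc z))))))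
          (*-zeroʳ (δ (suc i) (suc z * suc y))))
  count (suc i) (suc j) i≤a j≤b with decomposition-exists i j
  ... | x₀ , y₀ , z₀ , d@(y₀<x₀ , gcd≡1 , i≡ , j≡) =
    trans (nestedSum-single n admissible bound x₀<n y₀<x₀ admissible₀ z₀<bound
             (λ x y z y<x adm ≢ → δ*δ-≢ _ _ _ _ (λ i≡′ j≡′ →
                let x≡ , y≡ , z≡ = decomposition-unique (y<x , inFBinner⇒gcd≡1 n a (suc y) (suc x) adm , i≡′ , j≡′) d
                in ≢ x≡ y≡ z≡)))
          (cong₂ _*_ (trans (cong (δ (suc i)) (sym i≡)) (δ-refl (suc i)))
                     (trans (cong (δ (suc j)) (sym j≡)) (δ-refl (suc j))))
    where
    sh≤a : suc z₀ * suc y₀ ≤ a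
    sh≤a = subst (_≤ a) i≡ i≤a
    sq≤b : suc z₀ * (x₀ ∸ y₀) ≤ b
    sq≤b = subst (_≤ b) j≡ j≤b
    h≤a : suc y₀ ≤ a
    h≤a = ≤-trans (m≤n*m (suc y₀) (suc z₀)) sh≤a
    q≤b : x₀ ∸ y₀ ≤ b
    q≤b = ≤-trans (m≤n*m (x₀ ∸ y₀) (suc z₀)) sq≤b
    x₀<n : x₀ < n
    x₀<n = begin
      suc x₀               ≡⟨ cong suc (sym (m+[n∸m]≡n (<⇒≤ y₀<x₀))) ⟩
      suc y₀ + (x₀ ∸ y₀)   ≤⟨ +-mono-≤ h≤a q≤b ⟩
      a + b                ≡⟨ m+[n∸m]≡n a≤n ⟩
      n                    ∎
      where open ≤-Reasoning
    admissible₀ : admissible x₀ y₀ ≡ true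
    admissible₀ = inFBinner-intro n a (suc y₀) (suc x₀) x₀<n gcd≡1 h≤a q≤b
    z₀<bound : z₀ < bound x₀ y₀
    z₀<bound = ⊓-glb (*≤⇒≤/ (suc z₀) (suc y₀) a (s≤s z≤n) sh≤a) (*≤⇒≤/ (suc z₀) (x₀ ∸ y₀) b (m<n⇒0<n∸m y₀<x₀) sq≤b)

  sumFB≡binomialSum⁺*binomialSum⁺ : sumFB n a (innerSum a b) ≡ binomialSum⁺ a * binomialSum⁺ b
  sumFB≡binomialSum⁺*binomialSum⁺ = begin
    sumFB n a (innerSum a b)
      ≡⟨ sumFB≡fareySum ⟩
    fareySum (λ x y z → (a C (suc z * suc y)) * (b C (suc z * (x ∸ y))))
      ≡⟨ nestedSum-cong n admissible bound (λ x y z →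
           trans (cong₂ _*_ (binomial-as-δ-sum a (suc z * suc y)) (binomial-as-δ-sum b (suc z * (x ∸ y))))
                 (sumBelow-*-sumBelow (suc a) (suc b) (λ i → (a C i) * δ i (suc z * suc y)) (λ j → (b C j) * δ j (suc z * (x ∸ y))))) ⟩
    fareySum (λ x y z → sumBelow (suc a) λ i → sumBelow (suc b) λ j → ((a C i) * δ i (suc z * suc y)) * ((b C j) * δ j (suc z * (x ∸ y))))
      ≡⟨ nestedSum-sumBelow n admissible bound (suc a) _ ⟩
    sumBelow (suc a) (λ i → fareySum λ x y z → sumBelow (suc b) λ j → ((a C i) * δ i (suc z * suc y)) * ((b C j) * δ j (suc z * (x ∸ y))))
      ≡⟨ sumBelow-cong (suc a) (λ i i<1+a → trans (nestedSum-sumBelow n admissible bound (suc b) _)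
           (sumBelow-cong (suc b) (λ j j<1+b → countTerm i j (≤-pred i<1+a) (≤-pred j<1+b)))) ⟩
    sumBelow (suc a) (λ i → sumBelow (suc b) λ j → ((a C i) * sgn i) * ((b C j) * sgn j))
      ≡⟨ sym (sumBelow-*-sumBelow (suc a) (suc b) (λ i → (a C i) * sgn i) (λ j → (b C j) * sgn j)) ⟩
    sumBelow (suc a) (λ i → (a C i) * sgn i) * sumBelow (suc b) (λ j → (b C j) * sgn j)
      ≡⟨ sym (cong₂ _*_ (binomialSum⁺-as-sgn-sum a) (binomialSum⁺-as-sgn-sum b)) ⟩
    binomialSum⁺ a * binomialSum⁺ b ∎
    where
    open ≡-Reasoning
    interchange : ∀ c d u v → (c * u) * (d * v) ≡ (c * d) * (u * v)
    interchange = solve-∀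
    countTerm : ∀ i j → i ≤ a → j ≤ b →
      fareySum (λ x y z → ((a C i) * δ i (suc z * suc y)) * ((b C j) * δ j (suc z * (x ∸ y)))) ≡ ((a C i) * sgn i) * ((b C j) * sgn j)
    countTerm i j i≤a j≤b = begin
      fareySum (λ x y z → ((a C i) * δ i (suc z * suc y)) * ((b C j) * δ j (suc z * (x ∸ y))))
        ≡⟨ nestedSum-cong n admissible bound (λ _ _ _ → interchange (a C i) (b C j) _ _) ⟩
      fareySum (λ x y z → ((a C i) * (b C j)) * (δ i (suc z * suc y) * δ j (suc z * (x ∸ y))))
        ≡⟨ nestedSum-*ˡ n admissible bound ((a C i) * (b C j)) _ ⟩
      ((a C i) * (b C j)) * fareySum (λ x y z → δ i (suc z * suc y) * δ j (suc z * (x ∸ y)))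
        ≡⟨ cong (((a C i) * (b C j)) *_) (count i j i≤a j≤b) ⟩
      ((a C i) * (b C j)) * (sgn i * sgn j)
        ≡⟨ sym (interchange (a C i) (b C j) (sgn i) (sgn j)) ⟩
      ((a C i) * sgn i) * ((b C j) * sgn j) ∎

proposition2 : (n m : ℕ) → 2 ≤ n → 0 < m → m < n →
    (sumFB n m (innerSum m (n ∸ m)) ≡ sumFB n (n ∸ m) (innerSum (n ∸ m) m))
    × (sumFB n (n ∸ m) (innerSum (n ∸ m) m) + 2 ^ m + 2 ^ (n ∸ m) ≡ 2 ^ n + 1)
proposition2 n m _ _ m<n = trans left (trans (*-comm P Q) (sym middle)) , total
  where
  open ≡-Reasoning
  P = binomialSum⁺ m
  Q = binomialSum⁺ (n ∸ m)
  left : sumFB n m (innerSum m (n ∸ m)) ≡ P * Q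
  left = FareySum.sumFB≡binomialSum⁺*binomialSum⁺ n m (<⇒≤ m<n)
  middle : sumFB n (n ∸ m) (innerSum (n ∸ m) m) ≡ Q * P
  middle = subst (λ t → sumFB n (n ∸ m) (innerSum (n ∸ m) t) ≡ Q * binomialSum⁺ t) (m∸[m∸n]≡n (<⇒≤ m<n))
                 (FareySum.sumFB≡binomialSum⁺*binomialSum⁺ n (n ∸ m) (m∸n≤m n m))
  expand : ∀ p q → q * p + (1 + p) + (1 + q) ≡ (1 + p) * (1 + q) + 1
  expand = solve-∀
  2^n≡[1+P]*[1+Q] : 2 ^ n ≡ (1 + P) * (1 + Q)
  2^n≡[1+P]*[1+Q] = begin
    2 ^ n                 ≡⟨ cong (2 ^_) (sym (m+[n∸m]≡n (<⇒≤ m<n))) ⟩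
    2 ^ (m + (n ∸ m))     ≡⟨ ^-distribˡ-+-* 2 m (n ∸ m) ⟩
    2 ^ m * 2 ^ (n ∸ m)   ≡⟨ cong₂ _*_ (2^m≡1+binomialSum⁺ m) (2^m≡1+binomialSum⁺ (n ∸ m)) ⟩
    (1 + P) * (1 + Q)     ∎
  total : sumFB n (n ∸ m) (innerSum (n ∸ m) m) + 2 ^ m + 2 ^ (n ∸ m) ≡ 2 ^ n + 1
  total = begin
    sumFB n (n ∸ m) (innerSum (n ∸ m) m) + 2 ^ m + 2 ^ (n ∸ m)
      ≡⟨ cong₂ (λ t u → t + u + 2 ^ (n ∸ m)) middle (2^m≡1+binomialSum⁺ m) ⟩
    Q * P + (1 + P) + 2 ^ (n ∸ m)
      ≡⟨ cong (Q * P + (1 + P) +_) (2^m≡1+binomialSum⁺ (n ∸ m)) ⟩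
    Q * P + (1 + P) + (1 + Q)
      ≡⟨ expand P Q ⟩
    (1 + P) * (1 + Q) + 1
      ≡⟨ cong (_+ 1) (sym 2^n≡[1+P]*[1+Q]) ⟩
    2 ^ n + 1 ∎
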